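{- For any two failure trace tests $t_1,t_2$ there exists a failure trace test $t_1\lor t_2$ such that for every process $p$: $p\ \mathrm{may}\ (t_1\lor t_2)$ if and only if ($p\ \mathrm{may}\ t_1$ or $p\ \mathrm{may}\ t_2$).
   Context: Let $A$ be a countable set of visible actions and $\tau,\theta,\gamma$ distinct symbols not in $A$. A process is an LTS $p=(S,A,\rightarrow,s_0)$ with $S$ countable nonempty and $\rightarrow\subseteq S\times(A\cup\{\tau\})\times S$; states are identified with the processes rooted at them. A failure trace test is an LTS with labels in $A\cup\{\tau,\theta,\gamma\}$ in which every $\gamma$-transition leads to the state $\mathrm{stop}$, which has no outgoing transitions. The composition $p\|_\theta t$ has transitions: $p\|_\theta t\xrightarrow{\tau}p'\|_\theta t$ if $p\xrightarrow{\tau}p'$; $p\|_\theta t\xrightarrow{\tau}p\|_\theta t'$ if $t\xrightarrow{\tau}t'$; $p\|_\theta t\xrightarrow{\gamma}\mathrm{stop}$ if $t\xrightarrow{\gamma}\mathrm{stop}$; $p\|_\theta t\xrightarrow{a}p'\|_\theta t'$ if $a\in A$, $p\xrightarrow{a}p'$ and $t\xrightarrow{a}t'$; $p\|_\theta t\xrightarrow{\theta}p\|_\theta t'$ if $t\xrightarrow{\theta}t'$ and $p\|_\theta t$ has no transition labeled by any $x\in A\cup\{\tau,\gamma\}$. $p\ \mathrm{may}\ t$ iff there is a finite run of $p\|_\theta t$ starting at $p\|_\theta t$ whose last non-$\tau$ label is $\gamma$. -}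

module Defs where

open import Data.Nat using (ℕ)
open import Data.Product using (Σ; _×_; _,_; ∃)
open import Data.List using (List; []; _∷_)
open import Data.Maybe using (Maybe; just; nothing)
open import Relation.Nullary using (¬_)
open import Relation.Binary.PropositionalEquality using (_≡_)
open import Function.Definitions using (Injective)

Countable : Set → Set
Countable X = Σ (X → ℕ) (Injective _≡_ _≡_)

data PLabel (A : Set) : Set where
  act : A → PLabel A
  τ   : PLabel A

data TLabel (A : Set) : Set where
  tact : A → TLabel A
  tτ   : TLabel A
  tθ   : TLabel A
  tγ   : TLabel A

-- A process: LTS (S, A ∪ {τ}, →, s₀) with S countable and nonempty (witnessed by s₀).
record Process (A : Set) : Set₁ where
  field
    St        : Set
    countable : Countable St
    _⟶[_]_    : St → PLabel A → St → Set
    s₀        : St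

record Test (A : Set) : Set₁ where
  field
    St        : Set
    countable : Countable St
    _⟶[_]_    : St → TLabel A → St → Set
    s₀        : St
    stop      : St
    stop-dead : ∀ l s → ¬ (stop ⟶[ l ] s)
    γ-to-stop : ∀ s s' → s ⟶[ tγ ] s' → s' ≡ stop

module Composition {A : Set} (p : Process A) (t : Test A) where
  private
    module P = Process p
    module T = Test t

  data CState : Set where
    ⟨_∥_⟩ : P.St → T.St → CState
    stopC : CState

  data StepNθ : CState → TLabel A → CState → Set where
    τ-p : ∀ {p₁ p₂ u} → p₁ P.⟶[ τ ] p₂ → StepNθ ⟨ p₁ ∥ u ⟩ tτ ⟨ p₂ ∥ u ⟩
    τ-t : ∀ {q u₁ u₂} → u₁ T.⟶[ tτ ] u₂ → StepNθ ⟨ q ∥ u₁ ⟩ tτ ⟨ q ∥ u₂ ⟩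
    γ-t : ∀ {q u} → u T.⟶[ tγ ] T.stop → StepNθ ⟨ q ∥ u ⟩ tγ stopC
    sync : ∀ {a p₁ p₂ u₁ u₂} → p₁ P.⟶[ act a ] p₂ → u₁ T.⟶[ tact a ] u₂ →
           StepNθ ⟨ p₁ ∥ u₁ ⟩ (tact a) ⟨ p₂ ∥ u₂ ⟩

  data Step : CState → TLabel A → CState → Set where
    nθ : ∀ {s l s'} → StepNθ s l s' → Step s l s'
    θ-t : ∀ {q u₁ u₂} → u₁ T.⟶[ tθ ] u₂ →
          ¬ (∃ λ l → ∃ λ s' → StepNθ ⟨ q ∥ u₁ ⟩ l s') →
          Step ⟨ q ∥ u₁ ⟩ tθ ⟨ q ∥ u₂ ⟩

  data Run : CState → List (TLabel A) → Set where
    done : ∀ {s} → Run s []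
    step : ∀ {s l s' ls} → Step s l s' → Run s' ls → Run s (l ∷ ls)

lastNonτ : {A : Set} → List (TLabel A) → Maybe (TLabel A)
lastNonτ [] = nothing
lastNonτ (l ∷ ls) with lastNonτ ls
... | just x = just x
... | nothing with l
...   | tτ = nothing
...   | l' = just l'

_may_ : {A : Set} → Process A → Test A → Set
_may_ {A} p t = ∃ λ ls → Run ⟨ Process.s₀ p ∥ Test.s₀ t ⟩ ls × lastNonτ ls ≡ just tγ
  where open Composition p t

module Submission where

-- The disjunction t₁ ∨ t₂ of two tests is the test that starts with an
-- internal (τ) choice between t₁ and t₂ and then behaves like the chosen one,
-- except that all γ-transitions of both tests are redirected to one shared
-- stop state.
--
-- Runs of p ‖θ t
--      transfer along a bisimulation; both directions are needed because the
--      θ-rule has a negative premise ("no other transition is enabled").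
--   2. The choice test over a family (tᵢ)ᵢ.  Each tᵢ is bisimilar to the
--      choice test, with sᵢ related to "inside tᵢ at sᵢ" and stopᵢ to the
--      shared stop.  A successful run from the initial choice state must
--      resolve the choice by a test-τ, interleaved only with process τ's;
--      hence p may (choice t) iff p may tᵢ for some i.
--   3. Countability: the choice test is countable when its component states
--      are, which for the two-element index Bool follows from interleaving
--      ℕ into even and odd numbers.  lemma4 is the case of Bool.

open import Defs
open import Data.Bool using (Bool; true; false; if_then_else_)
open import Data.Empty using (⊥-elim)
open import Data.List using (List; []; _∷_)
open import Data.Maybe using (just; nothing)
open import Data.Nat using (ℕ; suc; _*_; _+_)
open import Data.Nat.Properties using (suc-injective; *-cancelˡ-≡; even≢odd)
open import Data.Product using (Σ; ∃; ∃-syntax; _×_; _,_; proj₁; proj₂)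
open import Data.Sum using (_⊎_; inj₁; inj₂)
open import Function.Bundles using (_⇔_; mk⇔; module Equivalence)
open import Relation.Nullary using (¬_)
open import Relation.Binary.PropositionalEquality
  using (_≡_; refl; sym; trans; cong; subst)

lastNonτ-τ : {A : Set} (ls : List (TLabel A)) → lastNonτ (tτ ∷ ls) ≡ lastNonτ ls
lastNonτ-τ ls with lastNonτ ls
... | just _  = refl
... | nothing = refl

module Success {A : Set} (p : Process A) (t : Test A) where
  open Composition p t

  Succeeds : CState → Set
  Succeeds s = ∃ λ ls → Run s ls × lastNonτ ls ≡ just tγ

  succeeds-τ : ∀ {s s'} → Step s tτ s' → Succeeds s' → Succeeds s
  succeeds-τ st (ls , r , last) = tτ ∷ ls , step st r , trans (lastNonτ-τ ls) last

-- A bisimulation between two tests.  No special treatment of stop is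
-- required: γ always leads to stop, after which the composition is dead.
record Bisimulation {A : Set} (t t' : Test A) : Set₁ where
  private
    module T  = Test t
    module T' = Test t'
  field
    _∼_   : T.St → T'.St → Set
    forth : ∀ {u v l u'} → u ∼ v → u T.⟶[ l ] u' → ∃[ v' ] (v T'.⟶[ l ] v' × u' ∼ v')
    back  : ∀ {u v l v'} → u ∼ v → v T'.⟶[ l ] v' → ∃[ u' ] (u T.⟶[ l ] u' × u' ∼ v')

converse : {A : Set} {t t' : Test A} → Bisimulation t t' → Bisimulation t' t
converse B = record { _∼_ = λ v u → u ∼ v ; forth = back ; back = forth }
  where open Bisimulation B

module StepTransfer {A : Set} (p : Process A) {t t' : Test A} (B : Bisimulation t t') where
  open Bisimulation B
  module T' = Test t'
  module C  = Composition p t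
  module C' = Composition p t'

  data _≈_ : C.CState → C'.CState → Set where
    pair  : ∀ {q u v} → u ∼ v → C.⟨ q ∥ u ⟩ ≈ C'.⟨ q ∥ v ⟩
    stops : C.stopC ≈ C'.stopC

  stepNθ-transfer : ∀ {s s' l r} → s ≈ s' → C.StepNθ s l r →
                    ∃[ r' ] (C'.StepNθ s' l r' × r ≈ r')
  stepNθ-transfer (pair u∼v) (C.τ-p e) = _ , C'.τ-p e , pair u∼v
  stepNθ-transfer (pair u∼v) (C.τ-t e) with forth u∼v e
  ... | _ , e' , u'∼v' = _ , C'.τ-t e' , pair u'∼v'
  stepNθ-transfer (pair u∼v) (C.γ-t e) with forth u∼v e
  ... | _ , e' , _ = _ , C'.γ-t (subst (_ T'.⟶[ tγ ]_) (T'.γ-to-stop _ _ e') e') , stops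
  stepNθ-transfer (pair u∼v) (C.sync e f) with forth u∼v f
  ... | _ , f' , u'∼v' = _ , C'.sync e f' , pair u'∼v'

module RunTransfer {A : Set} (p : Process A) {t t' : Test A} (B : Bisimulation t t') where
  open Bisimulation B
  open StepTransfer p B
  module Back = StepTransfer p (converse B)

  -- The negative premise of the θ-rule is preserved, using the converse.
  blocked-transfer : ∀ {q u v} → u ∼ v →
    ¬ (∃ λ l → ∃ λ r → C.StepNθ C.⟨ q ∥ u ⟩ l r) →
    ¬ (∃ λ l → ∃ λ r' → C'.StepNθ C'.⟨ q ∥ v ⟩ l r')
  blocked-transfer u∼v blocked (l , _ , st') with Back.stepNθ-transfer (Back.pair u∼v) st'
  ... | r , st , _ = blocked (l , r , st)

  run-transfer : ∀ {s s' ls} → s ≈ s' → C.Run s ls → C'.Run s' ls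
  run-transfer _ C.done = C'.done
  run-transfer rel (C.step (C.nθ st) r) with stepNθ-transfer rel st
  ... | _ , st' , rel' = C'.step (C'.nθ st') (run-transfer rel' r)
  run-transfer (pair u∼v) (C.step (C.θ-t e blocked) r) with forth u∼v e
  ... | _ , e' , u'∼v' = C'.step (C'.θ-t e' (blocked-transfer u∼v blocked)) (run-transfer (pair u'∼v') r)

  succeeds-transfer : ∀ {s s'} → s ≈ s' → Success.Succeeds p t s → Success.Succeeds p t' s'
  succeeds-transfer rel (ls , r , last) = ls , run-transfer rel r , last

data NotGamma {A : Set} : TLabel A → Set where
  visible  : ∀ {a} → NotGamma (tact a)
  internal : NotGamma tτ
  timeout  : NotGamma tθ

module Choice {A I : Set} (ts : I → Test A) where
  open Test using (St; s₀; stop)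
  module Ts (i : I) = Test (ts i)

  data ChoiceSt : Set where
    start  : ChoiceSt
    finish : ChoiceSt
    inside : (i : I) → St (ts i) → ChoiceSt

  data _⟶[_]_ : ChoiceSt → TLabel A → ChoiceSt → Set where
    choose  : ∀ i → start ⟶[ tτ ] inside i (s₀ (ts i))
    move    : ∀ {i u l u'} → Ts._⟶[_]_ i u l u' → NotGamma l → inside i u ⟶[ l ] inside i u'
    succeed : ∀ {i u} → Ts._⟶[_]_ i u tγ (stop (ts i)) → inside i u ⟶[ tγ ] finish

  code : (Σ I (λ i → St (ts i)) → ℕ) → ChoiceSt → ℕ
  code c start        = 0
  code c finish       = 1
  code c (inside i u) = 2 + c (i , u)

  code-injective : (c : Countable (Σ I (λ i → St (ts i)))) →
                   ∀ {x y} → code (proj₁ c) x ≡ code (proj₁ c) y → x ≡ y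
  code-injective c {start}      {start}      _ = refl
  code-injective c {finish}     {finish}     _ = refl
  code-injective c {inside i u} {inside j v} eq
    with refl ← proj₂ c (suc-injective (suc-injective eq)) = refl

  choice : Countable (Σ I (λ i → St (ts i))) → Test A
  choice c = record
    { St        = ChoiceSt
    ; countable = code (proj₁ c) , code-injective c
    ; _⟶[_]_    = _⟶[_]_
    ; s₀        = start
    ; stop      = finish
    ; stop-dead = λ _ _ ()
    ; γ-to-stop = λ { _ _ (move _ ()) ; _ _ (succeed _) → refl }
    }

  data Embedded (i : I) : St (ts i) → ChoiceSt → Set where
    embedded : ∀ {u} → Embedded i u (inside i u)
    stopped  : Embedded i (stop (ts i)) finish

  embedding : (c : Countable (Σ I (λ i → St (ts i)))) (i : I) → Bisimulation (ts i) (choice c)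
  embedding c i = record { _∼_ = Embedded i ; forth = forth ; back = back }
    where
      forth : ∀ {u v l u'} → Embedded i u v → Ts._⟶[_]_ i u l u' →
              ∃[ v' ] (v ⟶[ l ] v' × Embedded i u' v')
      forth {l = tact _} embedded e = _ , move e visible , embedded
      forth {l = tτ}     embedded e = _ , move e internal , embedded
      forth {l = tθ}     embedded e = _ , move e timeout , embedded
      forth {l = tγ}     embedded e with refl ← Ts.γ-to-stop i _ _ e = _ , succeed e , stopped
      forth stopped e = ⊥-elim (Ts.stop-dead i _ _ e)

      back : ∀ {u v l v'} → Embedded i u v → v ⟶[ l ] v' →
             ∃[ u' ] (Ts._⟶[_]_ i u l u' × Embedded i u' v')
      back embedded (move e _)  = _ , e , embedded
      back embedded (succeed e) = _ , e , stopped

  module _ (c : Countable (Σ I (λ i → St (ts i)))) (p : Process A) where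
    open Success p (choice c)
    open Composition p (choice c)

    -- Before the choice is resolved only the process can move internally.
    resolve : ∀ {q ls} → Run ⟨ q ∥ start ⟩ ls → lastNonτ ls ≡ just tγ →
              ∃[ i ] Succeeds ⟨ q ∥ inside i (s₀ (ts i)) ⟩
    resolve done ()
    resolve {ls = tτ ∷ ls} (step (nθ (τ-p e)) r) last
      with resolve r (trans (sym (lastNonτ-τ ls)) last)
    ... | i , success = i , succeeds-τ (nθ (τ-p e)) success
    resolve {ls = tτ ∷ ls} (step (nθ (τ-t (choose i))) r) last =
      i , ls , r , trans (sym (lastNonτ-τ ls)) last

    choice-may : (p may choice c) ⇔ (∃[ i ] (p may ts i))
    choice-may = mk⇔ to from
      where
        to : p may choice c → ∃[ i ] (p may ts i)
        to (_ , r , last) with resolve r last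
        ... | i , success-i =
          i , RunTransfer.succeeds-transfer p (converse (embedding c i)) (StepTransfer.pair embedded) success-i
        from : ∃[ i ] (p may ts i) → p may choice c
        from (i , success-i) =
          succeeds-τ (nθ (τ-t (choose i)))
            (RunTransfer.succeeds-transfer p (embedding c i) (StepTransfer.pair embedded) success-i)

Σ-Bool-countable : (F : Bool → Set) → Countable (F true) → Countable (F false) →
                   Countable (Σ Bool F)
Σ-Bool-countable F (c₁ , c₁-inj) (c₂ , c₂-inj) = code , code-injective
  where
    code : Σ Bool F → ℕ
    code (true  , x) = 2 * c₁ x
    code (false , x) = suc (2 * c₂ x)

    code-injective : ∀ {x y} → code x ≡ code y → x ≡ y
    code-injective {true  , x} {true  , y} eq = cong (true ,_) (c₁-inj (*-cancelˡ-≡ _ _ 2 eq))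
    code-injective {true  , x} {false , y} eq = ⊥-elim (even≢odd (c₁ x) (c₂ y) eq)
    code-injective {false , x} {true  , y} eq = ⊥-elim (even≢odd (c₁ y) (c₂ x) (sym eq))
    code-injective {false , x} {false , y} eq =
      cong (false ,_) (c₂-inj (*-cancelˡ-≡ _ _ 2 (suc-injective eq)))

lemma4 : (A : Set) → Countable A → (t₁ t₂ : Test A) →
    Σ (Test A) (λ t → (p : Process A) → (p may t) ⇔ ((p may t₁) ⊎ (p may t₂)))
lemma4 A _ t₁ t₂ = choice countable , λ p → mk⇔ (to p) (from p)
  where
    ts : Bool → Test A
    ts b = if b then t₁ else t₂
    open Choice ts
    countable : Countable (Σ Bool (λ b → Test.St (ts b)))
    countable = Σ-Bool-countable (λ b → Test.St (ts b)) (Test.countable t₁) (Test.countable t₂)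

    to : (p : Process A) → p may choice countable → (p may t₁) ⊎ (p may t₂)
    to p success with Equivalence.to (choice-may countable p) success
    ... | true  , success₁ = inj₁ success₁
    ... | false , success₂ = inj₂ success₂
    from : (p : Process A) → (p may t₁) ⊎ (p may t₂) → p may choice countable
    from p (inj₁ success₁) = Equivalence.from (choice-may countable p) (true , success₁)
    from p (inj₂ success₂) = Equivalence.from (choice-may countable p) (false , success₂)
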